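{- Let $a$ be a positive odd integer, let $k,m$ be nonnegative integers and let $n$ be a positive integer. If $n\equiv \frac{a-1}2\pmod 2$, then $$t(a,3a,16k+4,16m+4;n)=\frac 23N(a,3a,16k+4,16m+4;8n+16k+16m+4a+8)-2N(a,3a,16k+4,16m+4;2n+4k+4m+a+2).$$
   Context: For positive integers $a,b,c,d$ and a nonnegative integer $n$, $N(a,b,c,d;n)$ denotes the number of $(x,y,z,w)\in\mathbb Z^4$ with $n=ax^2+by^2+cz^2+dw^2$, and $t(a,b,c,d;n)$ denotes the number of $(x,y,z,w)\in\mathbb Z^4$ with $n=a\frac{x(x-1)}2+b\frac{y(y-1)}2+c\frac{z(z-1)}2+d\frac{w(w-1)}2$. -}

module Defs where

open import Data.Nat using (ℕ; zero; suc; _+_; _*_)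
open import Data.Integer as ℤ using (ℤ; +_; -[1+_])
open import Data.List using (List; []; _∷_; map; concatMap; filter; length; upTo)
open import Data.Product using (_×_; _,_)
open import Relation.Binary.PropositionalEquality using (_≡_)
import Data.Integer.Properties as ℤP

range : ℕ → List ℤ
range B = map (λ i → + i) (upTo (suc B)) Data.List.++ map (λ i → -[1+ i ]) (upTo B)

box : ℕ → List (ℤ × ℤ × ℤ × ℤ)
box B = concatMap (λ x → concatMap (λ y → concatMap (λ z → map (λ w → (x , y , z , w)) (range B)) (range B)) (range B)) (range B)

countIn : ℕ → (ℤ × ℤ × ℤ × ℤ → ℤ) → ℤ → ℕ
countIn B f n = length (filter (λ q → f q ℤ.≟ n) (box B))

quadForm : ℕ → ℕ → ℕ → ℕ → ℤ × ℤ × ℤ × ℤ → ℤ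
quadForm a b c d (x , y , z , w) =
  + a ℤ.* (x ℤ.* x) ℤ.+ + b ℤ.* (y ℤ.* y) ℤ.+ + c ℤ.* (z ℤ.* z) ℤ.+ + d ℤ.* (w ℤ.* w)

tri2 : ℤ → ℤ
tri2 x = x ℤ.* (x ℤ.- + 1)

triForm2 : ℕ → ℕ → ℕ → ℕ → ℤ × ℤ × ℤ × ℤ → ℤ
triForm2 a b c d (x , y , z , w) =
  + a ℤ.* tri2 x ℤ.+ + b ℤ.* tri2 y ℤ.+ + c ℤ.* tri2 z ℤ.+ + d ℤ.* tri2 w

-- N(a,b,c,d;n) = #{(x,y,z,w) ∈ ℤ^4 : n = a x²+b y²+c z²+d w²}.
-- For a,b,c,d ≥ 1 every solution has |x|,|y|,|z|,|w| ≤ n, so counting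
-- in the box [-n,n]^4 gives exactly the number of all integer solutions.
N : ℕ → ℕ → ℕ → ℕ → ℕ → ℕ
N a b c d n = countIn n (quadForm a b c d) (+ n)

-- t(a,b,c,d;n) = #{(x,y,z,w) ∈ ℤ^4 : n = Σ a x(x-1)/2}, written as
-- 2n = Σ a x(x-1) (equivalent, all x(x-1) even).  For a,b,c,d ≥ 1 every
-- solution has x(x-1) ≤ 2n, hence |x| ≤ 2n+1; the box [-(2n+1), 2n+1]^4
-- therefore contains all solutions.
t : ℕ → ℕ → ℕ → ℕ → ℕ → ℕ
t a b c d n = countIn (suc (2 * n)) (triForm2 a b c d) (+ (2 * n))

-- Write F = a x² + 3a y² + c z² + d w² with a odd and c ≡ d ≡ 4 (mod 16). Reducing F(x, y, z, w) = M ≡ 12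
-- (mod 16) shows that every solution has z ≡ w (mod 2) and x² + 3y² ≡ 4 (mod 8), i.e. x and y are both odd,
-- or both even with (x + y)/2 odd. Viewing (x, y) as x + y√-3, multiplication by the units (1 ± √-3)/2 of
-- ℤ[(1 + √-3)/2] preserves x² + 3y² and fixes z and w; it maps the odd solutions with (x + y)/2 even, and
-- those with (x + y)/2 odd, bijectively onto the even ones. So if e₁ and e₀ count the solutions with x, y even
-- and z odd, resp. even, then N(M) = 3e₁ + 3e₀. The substitutions x ↦ 2x - 1 and x ↦ 2x identify t(n) with
-- the solutions of F = 8n + 4a + c + d = M with all coordinates odd, of which there are 2e₁, and N(M/4) with
-- those with all coordinates even, of which there are e₀. Hence 3t(n) + 6N(M/4) = 6e₁ + 6e₀ = 2N(M).

module Submission where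

open import Defs
open import Agda.Builtin.FromNat using (Number; fromNat)
open import Data.Empty using (⊥-elim)
import Data.Integer as Int
open Int using (ℤ; +_; -[1+_]; ∣_∣; _/ℕ_; _%ℕ_)
open import Data.Integer.DivMod using (a≡a%ℕn+[a/ℕn]*n; n%ℕd<d)
import Data.Integer.Literals as ℤLiterals
import Data.Integer.Properties as ℤP
open import Data.Integer.Tactic.RingSolver using (solve-∀; solve)
open import Data.List using (List; []; _∷_; map; filter; length; concatMap; upTo)
import Data.List.Properties as ListP
open import Data.List.Membership.Propositional using (_∈_)
open import Data.List.Membership.Propositional.Properties
  using (∈-map⁺; ∈-map⁻; ∈-filter⁺; ∈-filter⁻; ∈-concatMap⁺; ∈-++⁺ˡ; ∈-++⁺ʳ; ∈-upTo⁺)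
open import Data.List.Membership.Propositional.Properties.WithK using (unique∧set⇒bag)
open import Data.List.Relation.Binary.BagAndSetEquality using (∼bag⇒↭)
open import Data.List.Relation.Binary.Permutation.Propositional.Properties using (↭-length)
import Data.List.Relation.Unary.All as All
import Data.List.Relation.Unary.All.Properties as AllP
import Data.List.Relation.Unary.AllPairs as AllPairs
import Data.List.Relation.Unary.AllPairs.Properties as AllPairsP
import Data.List.Relation.Unary.Any as Any
open import Data.List.Relation.Unary.Unique.Propositional using (Unique)
import Data.List.Relation.Unary.Unique.Propositional.Properties as Unique
open import Data.Nat as ℕ using (ℕ; zero; suc; _≤_; _<_; s≤s; z≤n)
open import Data.Nat.DivMod using (m≡m%n+[m/n]*n; [m+kn]%n≡m%n; m*n/n≡m)
import Data.Nat.Literals as ℕLiterals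
import Data.Nat.Properties as ℕP
import Data.Nat.Tactic.RingSolver as ℕSolver
open import Data.Product using (∃-syntax; _×_; _,_; proj₁; proj₂)
open import Data.Sum using (_⊎_; inj₁; inj₂)
open import Data.Unit using (⊤; tt)
open import Level using (0ℓ)
open import Relation.Binary.PropositionalEquality
open import Relation.Nullary using (¬_; yes; no)
open import Relation.Nullary.Decidable using (map′; _×-dec_)
open import Relation.Unary using (Pred; Decidable; _≐_; ∁)
open import Relation.Unary.Properties using (_∩?_; ∁?)
open import Function using (_∘_)
open import Function.Bundles using (mk⇔)

instance
  ℤ-number : Number ℤ
  ℤ-number = ℤLiterals.number

  ℕ-number : Number ℕ
  ℕ-number = ℕLiterals.number

  literal-constraint : ⊤
  literal-constraint = tt

module Counting where

  count : ∀ {a p} {A : Set a} {P : Pred A p} → Decidable P → List A → ℕ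
  count P? xs = length (filter P? xs)

  module _ {a p q} {A : Set a} {P : Pred A p} {Q : Pred A q} (P? : Decidable P) (Q? : Decidable Q) where

    count-split : ∀ xs → count P? xs ≡ count (P? ∩? Q?) xs ℕ.+ count (P? ∩? ∁? Q?) xs
    count-split [] = refl
    count-split (x ∷ xs) with P? x | Q? x
    ... | yes _ | yes _ = cong suc (count-split xs)
    ... | yes _ | no _  = trans (cong suc (count-split xs)) (sym (ℕP.+-suc _ _))
    ... | no _  | _     = count-split xs

    count-≐ : P ≐ Q → ∀ xs → count P? xs ≡ count Q? xs
    count-≐ P≐Q xs = cong length (ListP.filter-≐ P? Q? P≐Q xs)

  count-bijection : ∀ {a b p q} {A : Set a} {B : Set b} {P : Pred A p} {Q : Pred B q}
    (P? : Decidable P) (Q? : Decidable Q) {xs : List A} {ys : List B} (f : A → B) (g : B → A) →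
    Unique xs → Unique ys → (∀ {x} → P x → x ∈ xs) → (∀ {y} → Q y → y ∈ ys) →
    (∀ {x} → P x → Q (f x) × g (f x) ≡ x) →
    (∀ {y} → Q y → P (g y) × f (g y) ≡ y) →
    count P? xs ≡ count Q? ys
  count-bijection {Q = Q} P? Q? {xs} {ys} f g xs! ys! P⊆xs Q⊆ys forth back = begin
    length (filter P? xs)         ≡⟨ sym (ListP.length-map f (filter P? xs)) ⟩
    length (map f (filter P? xs))
      ≡⟨ ↭-length (∼bag⇒↭ (unique∧set⇒bag image! (Unique.filter⁺ Q? ys!) (mk⇔ into onto))) ⟩
    length (filter Q? ys)         ∎
    where
    open ≡-Reasoning
    retraction : All.All (λ x → g (f x) ≡ x) (filter P? xs)
    retraction = All.tabulate (λ x∈ → proj₂ (forth (proj₂ (∈-filter⁻ P? {xs = xs} x∈))))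
    image! : Unique (map f (filter P? xs))
    image! = Unique.map⁻ (subst Unique g∘f≡id (Unique.filter⁺ P? xs!))
      where
      g∘f≡id : filter P? xs ≡ map g (map f (filter P? xs))
      g∘f≡id = sym (trans (sym (ListP.map-∘ {g = g} {f = f} (filter P? xs))) (ListP.map-id-local retraction))
    into : ∀ {y} → y ∈ map f (filter P? xs) → y ∈ filter Q? ys
    into y∈ with ∈-map⁻ f y∈
    ... | x , x∈ , refl = ∈-filter⁺ Q? (Q⊆ys Q[fx]) Q[fx]
      where
      Q[fx] : Q (f x)
      Q[fx] = proj₁ (forth (proj₂ (∈-filter⁻ P? {xs = xs} x∈)))
    onto : ∀ {y} → y ∈ filter Q? ys → y ∈ map f (filter P? xs)
    onto y∈ with back (proj₂ (∈-filter⁻ Q? {xs = ys} y∈))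
    ... | P[gy] , f[gy]≡y = subst (_∈ map f (filter P? xs)) f[gy]≡y (∈-map⁺ f (∈-filter⁺ P? (P⊆xs P[gy]) P[gy]))

module EuclideanDivision where
  open Int using (_+_; _*_; _-_; -_)

  pos-*-+ : ∀ n k r → + (n ℕ.* k ℕ.+ r) ≡ + n * + k + + r
  pos-*-+ n k r = trans (ℤP.pos-+ (n ℕ.* k) r) (cong (_+ + r) (ℤP.pos-* n k))

  private
    multiple-between : ∀ {n r s} k → r < n → s < n → + n * k + + r ≡ + s → k ≡ 0
    multiple-between (+ zero) _ _ _ = refl
    multiple-between {n} {r} {s} (+ suc j) _ s<n eq =
      ⊥-elim (ℕP.<⇒≱ s<n (ℕP.≤-trans (ℕP.m≤m*n n (suc j))
                                     (ℕP.≤-trans (ℕP.m≤m+n _ r) (ℕP.≤-reflexive nk+r≡s))))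
      where
      nk+r≡s : n ℕ.* suc j ℕ.+ r ≡ s
      nk+r≡s = ℤP.+-injective (trans (pos-*-+ n (suc j) r) eq)
    multiple-between {n} {r} {s} -[1+ j ] r<n _ eq =
      ⊥-elim (ℕP.<⇒≱ r<n (ℕP.≤-trans (ℕP.m≤m*n n (suc j))
                                     (ℕP.≤-trans (ℕP.m≤m+n _ s) (ℕP.≤-reflexive (sym r≡nk+s)))))
      where
      shift : ∀ N K R → R ≡ N * K + (N * (- K) + R)
      shift = solve-∀
      r≡nk+s : r ≡ n ℕ.* suc j ℕ.+ s
      r≡nk+s = ℤP.+-injective (trans (shift (+ n) (+ (suc j)) (+ r))
                                     (trans (cong (_+_ (+ n * + (suc j))) eq) (sym (pos-*-+ n (suc j) s))))

    difference : ∀ N Q Q′ R R′ → N * Q + R ≡ N * Q′ + R′ → N * (Q - Q′) + R ≡ R′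
    difference N Q Q′ R R′ e = begin
      N * (Q - Q′) + R       ≡⟨ solve (N ∷ Q ∷ Q′ ∷ R ∷ []) ⟩
      N * Q + R - N * Q′     ≡⟨ cong (_- N * Q′) e ⟩
      N * Q′ + R′ - N * Q′   ≡⟨ solve (N ∷ Q′ ∷ R′ ∷ []) ⟩
      R′                     ∎
      where open ≡-Reasoning

  divMod-unique : ∀ {n q q′ r r′} → r < n → r′ < n → + n * q + + r ≡ + n * q′ + + r′ → q ≡ q′ × r ≡ r′
  divMod-unique {n} {q} {q′} {r} {r′} r<n r′<n eq = ℤP.i-j≡0⇒i≡j q q′ k≡0 , ℤP.+-injective r≡r′
    where
    open ≡-Reasoning
    nk+r≡r′ : + n * (q - q′) + + r ≡ + r′
    nk+r≡r′ = difference (+ n) q q′ (+ r) (+ r′) eq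
    k≡0 : q - q′ ≡ 0
    k≡0 = multiple-between (q - q′) r<n r′<n nk+r≡r′
    r≡r′ : + r ≡ + r′
    r≡r′ = begin
      + r                    ≡⟨ cong (_+ + r) (sym (ℤP.*-zeroʳ (+ n))) ⟩
      + n * 0 + + r          ≡⟨ cong (λ k → + n * k + + r) (sym k≡0) ⟩
      + n * (q - q′) + + r   ≡⟨ nk+r≡r′ ⟩
      + r′                   ∎

module Parity where
  open Int using (_+_; _*_; _-_; -_)
  open EuclideanDivision

  half : ℤ → ℤ
  half x = x /ℕ 2

  record Odd (x : ℤ) : Set where
    constructor mkOdd
    field remainder : x %ℕ 2 ≡ 1

  odd? : Decidable Odd
  odd? x = map′ mkOdd Odd.remainder (x %ℕ 2 ℕ.≟ 1)

  x≡2[x/2]+x%2 : ∀ x → x ≡ 2 * half x + + (x %ℕ 2)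
  x≡2[x/2]+x%2 x = trans (a≡a%ℕn+[a/ℕn]*n x 2)
                         (trans (ℤP.+-comm (+ (x %ℕ 2)) (half x * 2)) (cong (_+ + (x %ℕ 2)) (ℤP.*-comm (half x) 2)))

  half-%-unique : ∀ q r → r < 2 → half (2 * q + + r) ≡ q × (2 * q + + r) %ℕ 2 ≡ r
  half-%-unique q r r<2 = divMod-unique (n%ℕd<d (2 * q + + r) 2) r<2 (sym (x≡2[x/2]+x%2 (2 * q + + r)))

  half-exact : ∀ {x} q → x ≡ 2 * q → half x ≡ q
  half-exact q refl = subst (λ t → half t ≡ q) (ℤP.+-identityʳ (2 * q)) (proj₁ (half-%-unique q 0 (s≤s z≤n)))

  even-double : ∀ q → (2 * q) %ℕ 2 ≡ 0
  even-double q = subst (λ t → t %ℕ 2 ≡ 0) (ℤP.+-identityʳ (2 * q)) (proj₂ (half-%-unique q 0 (s≤s z≤n)))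

  ¬odd-double : ∀ q → ¬ Odd (2 * q)
  ¬odd-double q (mkOdd r) = ℕP.0≢1+n (trans (sym (even-double q)) r)

  odd-double+1 : ∀ q → Odd (2 * q + 1)
  odd-double+1 q = mkOdd (proj₂ (half-%-unique q 1 (s≤s (s≤s z≤n))))

  odd-by : ∀ {x} k → x ≡ 2 * k + 1 → Odd x
  odd-by k refl = odd-double+1 k

  ¬odd-by : ∀ {x} k → x ≡ 2 * k → ¬ Odd x
  ¬odd-by k refl = ¬odd-double k

  half-exact-odd : ∀ {x} q → x ≡ 2 * q + 1 → half x ≡ q
  half-exact-odd q refl = proj₁ (half-%-unique q 1 (s≤s (s≤s z≤n)))

  odd⇒ : ∀ {x} → Odd x → x ≡ 2 * half x + 1
  odd⇒ {x} (mkOdd r) = subst (λ t → x ≡ 2 * half x + + t) r (x≡2[x/2]+x%2 x)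

  ¬odd⇒ : ∀ {x} → ¬ Odd x → x ≡ 2 * half x
  ¬odd⇒ {x} x-even with x %ℕ 2 in r | n%ℕd<d x 2
  ... | 0 | _ = trans (x≡2[x/2]+x%2 x) (trans (cong (λ t → 2 * half x + + t) r) (ℤP.+-identityʳ _))
  ... | 1 | _ = ⊥-elim (x-even (mkOdd r))
  ... | suc (suc _) | s≤s (s≤s ())

  [x+2k]%2≡x%2 : ∀ x k → (x + 2 * k) %ℕ 2 ≡ x %ℕ 2
  [x+2k]%2≡x%2 x k =
    subst (λ t → t %ℕ 2 ≡ x %ℕ 2) (sym x+2k≡) (proj₂ (half-%-unique (half x + k) (x %ℕ 2) (n%ℕd<d x 2)))
    where
    regroup : ∀ h r k → 2 * h + r + 2 * k ≡ 2 * (h + k) + r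
    regroup = solve-∀
    x+2k≡ : x + 2 * k ≡ 2 * (half x + k) + + (x %ℕ 2)
    x+2k≡ = trans (cong (_+ 2 * k) (x≡2[x/2]+x%2 x)) (regroup (half x) (+ (x %ℕ 2)) k)
  odd-shift : ∀ {x′} x k → x′ ≡ x + 2 * k → Odd x → Odd x′
  odd-shift x k refl (mkOdd r) = mkOdd (trans ([x+2k]%2≡x%2 x k) r)

  ¬odd-shift : ∀ {x′} x k → x′ ≡ x + 2 * k → ¬ Odd x → ¬ Odd x′
  ¬odd-shift x k refl x-even (mkOdd r) = x-even (mkOdd (trans (sym ([x+2k]%2≡x%2 x k)) r))

  odd⇒∃ : ∀ {x} → Odd x → ∃[ h ] x ≡ 2 * h + 1
  odd⇒∃ {x} x-odd = half x , odd⇒ x-odd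

  ¬odd⇒∃ : ∀ {x} → ¬ Odd x → ∃[ h ] x ≡ 2 * h
  ¬odd⇒∃ {x} x-even = half x , ¬odd⇒ x-even

  odd-resp : ∀ {x y} → x %ℕ 2 ≡ y %ℕ 2 → Odd y → Odd x
  odd-resp eq (mkOdd r) = mkOdd (trans eq r)

  private
    odd+even-sum : ∀ h j → 2 * h + 1 + 2 * j ≡ 2 * (h + j) + 1
    odd+even-sum = solve-∀
    odd+odd-sum : ∀ h j → 2 * h + 1 + (2 * j + 1) ≡ 2 * (h + j + 1)
    odd+odd-sum = solve-∀

  odd+even : ∀ {x y} → Odd x → ¬ Odd y → Odd (x + y)
  odd+even x-odd y-even with odd⇒∃ x-odd | ¬odd⇒∃ y-even
  ... | h , refl | j , refl = odd-by (h + j) (odd+even-sum h j)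

  odd+odd : ∀ {x y} → Odd x → Odd y → ¬ Odd (x + y)
  odd+odd x-odd y-odd with odd⇒∃ x-odd | odd⇒∃ y-odd
  ... | h , refl | j , refl = ¬odd-by (h + j + 1) (odd+odd-sum h j)

  same-parity⇒ : ∀ {x y} → x %ℕ 2 ≡ y %ℕ 2 → ∃[ s ] x ≡ 2 * s - y
  same-parity⇒ {x} {y} eq = s , (begin
    x                                     ≡⟨ x≡2[x/2]+x%2 x ⟩
    2 * half x + + (x %ℕ 2)               ≡⟨ cong (λ r → 2 * half x + + r) eq ⟩
    2 * half x + + (y %ℕ 2)               ≡⟨ regroup (half x) (half y) (+ (y %ℕ 2)) ⟩
    2 * s - (2 * half y + + (y %ℕ 2))     ≡⟨ cong (λ t → 2 * s - t) (sym (x≡2[x/2]+x%2 y)) ⟩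
    2 * s - y                             ∎)
    where
    open ≡-Reasoning
    s : ℤ
    s = half x + half y + + (y %ℕ 2)
    regroup : ∀ h h′ r → 2 * h + r ≡ 2 * (h + h′ + r) - (2 * h′ + r)
    regroup = solve-∀

  data Parity : ℤ → Set where
    even : ∀ h → Parity (+ 2 * h)
    odd  : ∀ h → Parity (+ 2 * h + + 1)

  parity : ∀ x → Parity x
  parity x with x %ℕ 2 | x≡2[x/2]+x%2 x | n%ℕd<d x 2
  ... | 0 | e | _ = subst Parity (sym (trans e (ℤP.+-identityʳ _))) (even (half x))
  ... | 1 | e | _ = subst Parity (sym e) (odd (half x))
  ... | suc (suc _) | _ | s≤s (s≤s ())

module Residues where
  open Int using (_+_; _*_; _-_; -_)
  open EuclideanDivision
  open Parity

  -- Exactly the pairs with x² + 3y² ≡ 4 (mod 8).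
  Admissible : ℤ → ℤ → Set
  Admissible x y = x %ℕ 2 ≡ y %ℕ 2 × (¬ Odd x → Odd (half (x + y)))

  odd-square : ∀ h → ∃[ T ] (2 * h + 1) * (2 * h + 1) ≡ 8 * T + 1
  odd-square h = by-parity (parity h)
    where
    by-parity : ∀ {h} → Parity h → ∃[ T ] (2 * h + 1) * (2 * h + 1) ≡ 8 * T + 1
    by-parity (even i) = 2 * i * i + i , solve (i ∷ [])
    by-parity (odd i)  = 2 * i * i + 3 * i + 1 , solve (i ∷ [])

  admissible-doubles : ∀ u v → Odd (u + v) → Admissible (2 * u) (2 * v)
  admissible-doubles u v u+v-odd =
    trans (even-double u) (sym (even-double v)) ,
    λ _ → subst Odd (sym (half-exact {2 * u + 2 * v} (u + v) (solve (u ∷ v ∷ [])))) u+v-odd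

  sum-of-odd-squares : ∀ {X Y} → ∃[ T ] X ≡ 8 * T + 1 → ∃[ T ] Y ≡ 8 * T + 1 → ∃[ K ] X + 3 * Y ≡ 8 * K + 4
  sum-of-odd-squares (T , refl) (T′ , refl) = T + 3 * T′ , solve (T ∷ T′ ∷ [])

  NormResidue : ℤ → ℤ → ℤ → Set
  NormResidue x y N = (Admissible x y × ∃[ K ] N ≡ 8 * K + 4)
                    ⊎ (∃[ K ] N ≡ 2 * K + 1)
                    ⊎ (∃[ K ] N ≡ 16 * K)

  norm-residue : ∀ x y → NormResidue x y (x * x + 3 * (y * y))
  norm-residue x y = by-parity (parity x) (parity y)
    where
    doubles : ∀ {u v} → Parity u → Parity v → NormResidue (2 * u) (2 * v) (2 * u * (2 * u) + 3 * (2 * v * (2 * v)))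
    doubles (odd h)  (odd j)  = inj₂ (inj₂ (h * h + h + 3 * j * j + 3 * j + 1 , solve (h ∷ j ∷ [])))
    doubles (even h) (even j) = inj₂ (inj₂ (h * h + 3 * j * j , solve (h ∷ j ∷ [])))
    doubles (odd h)  (even j) =
      inj₁ (admissible-doubles (2 * h + 1) (2 * j) (odd-by (h + j) (solve (h ∷ j ∷ []))) ,
            2 * h * h + 2 * h + 6 * j * j , solve (h ∷ j ∷ []))
    doubles (even h) (odd j)  =
      inj₁ (admissible-doubles (2 * h) (2 * j + 1) (odd-by (h + j) (solve (h ∷ j ∷ []))) ,
            2 * h * h + 6 * j * j + 6 * j + 1 , solve (h ∷ j ∷ []))
    by-parity : ∀ {x y} → Parity x → Parity y → NormResidue x y (x * x + 3 * (y * y))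
    by-parity (odd h)  (odd j)  =
      inj₁ ((trans (Odd.remainder (odd-double+1 h)) (sym (Odd.remainder (odd-double+1 j))) ,
             λ x-even → ⊥-elim (x-even (odd-double+1 h))) ,
            sum-of-odd-squares (odd-square h) (odd-square j))
    by-parity (odd h)  (even j) = inj₂ (inj₁ (2 * h * h + 2 * h + 6 * j * j , solve (h ∷ j ∷ [])))
    by-parity (even h) (odd j)  = inj₂ (inj₁ (2 * h * h + 6 * j * j + 6 * j + 1 , solve (h ∷ j ∷ [])))
    by-parity (even u) (even v) = doubles (parity u) (parity v)

  WeightedResidue : ℤ → ℤ → ℤ → Set
  WeightedResidue z w G = (z %ℕ 2 ≡ w %ℕ 2 × ∃[ K ] G ≡ 8 * K) ⊎ (∃[ K ] G ≡ 16 * K + 4)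

  private
    weighted-even-even : ∀ κ μ h j → (16 * κ + 4) * (2 * h * (2 * h)) + (16 * μ + 4) * (2 * j * (2 * j))
                          ≡ 8 * (2 * (4 * κ * h * h + h * h + 4 * μ * j * j + j * j))
    weighted-even-even = solve-∀
    weighted-odd-odd : ∀ κ μ h j → (16 * κ + 4) * ((2 * h + 1) * (2 * h + 1)) + (16 * μ + 4) * ((2 * j + 1) * (2 * j + 1))
                        ≡ 8 * (2 * (4 * κ * (h * h + h) + h * h + h + 4 * μ * (j * j + j) + j * j + j) + 2 * κ + 2 * μ + 1)
    weighted-odd-odd = solve-∀
    weighted-odd-even : ∀ κ μ h j → (16 * κ + 4) * ((2 * h + 1) * (2 * h + 1)) + (16 * μ + 4) * (2 * j * (2 * j))
                         ≡ 16 * (4 * κ * (h * h + h) + κ + h * h + h + 4 * μ * j * j + j * j) + 4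
    weighted-odd-even = solve-∀
    weighted-even-odd : ∀ κ μ h j → (16 * κ + 4) * (2 * h * (2 * h)) + (16 * μ + 4) * ((2 * j + 1) * (2 * j + 1))
                         ≡ 16 * (4 * κ * h * h + h * h + 4 * μ * (j * j + j) + μ + j * j + j) + 4
    weighted-even-odd = solve-∀

  weighted-residue : ∀ κ μ z w → WeightedResidue z w ((16 * κ + 4) * (z * z) + (16 * μ + 4) * (w * w))
  weighted-residue κ μ z w = by-parity (parity z) (parity w)
    where
    by-parity : ∀ {z w} → Parity z → Parity w → WeightedResidue z w ((16 * κ + 4) * (z * z) + (16 * μ + 4) * (w * w))
    by-parity (even h) (even j) =
      inj₁ (trans (even-double h) (sym (even-double j)) ,
            2 * (4 * κ * h * h + h * h + 4 * μ * j * j + j * j) , weighted-even-even κ μ h j)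
    by-parity (odd h)  (odd j)  =
      inj₁ (trans (Odd.remainder (odd-double+1 h)) (sym (Odd.remainder (odd-double+1 j))) ,
            2 * (4 * κ * (h * h + h) + h * h + h + 4 * μ * (j * j + j) + j * j + j) + 2 * κ + 2 * μ + 1 , weighted-odd-odd κ μ h j)
    by-parity (odd h)  (even j) = inj₂ (4 * κ * (h * h + h) + κ + h * h + h + 4 * μ * j * j + j * j , weighted-odd-even κ μ h j)
    by-parity (even h) (odd j)  = inj₂ (4 * κ * h * h + h * h + 4 * μ * (j * j + j) + μ + j * j + j , weighted-even-odd κ μ h j)

  private
    incongruent : ∀ n {X r r′} → r < n → r′ < n → r ≢ r′ →
                  ∃[ q ] X ≡ + n * q + + r → ¬ (∃[ q′ ] X ≡ + n * q′ + + r′)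
    incongruent _ r<n r′<n r≢r′ (_ , e) (_ , e′) = r≢r′ (proj₂ (divMod-unique r<n r′<n (trans (sym e) e′)))

    odd*[8K+4]+[16K′+4]≡0[mod8] : ∀ α K K′ → ∃[ q ] (2 * α + 1) * (8 * K + 4) + (16 * K′ + 4) ≡ 8 * q + 0
    odd*[8K+4]+[16K′+4]≡0[mod8] α K K′ = 2 * α * K + α + K + 2 * K′ + 1 , solve (α ∷ K ∷ K′ ∷ [])
    odd*odd+8K′≡1[mod2] : ∀ α K K′ → ∃[ q ] (2 * α + 1) * (2 * K + 1) + 8 * K′ ≡ 2 * q + 1
    odd*odd+8K′≡1[mod2] α K K′ = 2 * α * K + α + K + 4 * K′ , solve (α ∷ K ∷ K′ ∷ [])
    odd*odd+[16K′+4]≡1[mod2] : ∀ α K K′ → ∃[ q ] (2 * α + 1) * (2 * K + 1) + (16 * K′ + 4) ≡ 2 * q + 1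
    odd*odd+[16K′+4]≡1[mod2] α K K′ = 2 * α * K + α + K + 8 * K′ + 2 , solve (α ∷ K ∷ K′ ∷ [])
    odd*16K+8K′≡0[mod8] : ∀ α K K′ → ∃[ q ] (2 * α + 1) * (16 * K) + 8 * K′ ≡ 8 * q + 0
    odd*16K+8K′≡0[mod8] α K K′ = 2 * (2 * α + 1) * K + K′ , solve (α ∷ K ∷ K′ ∷ [])
    odd*16K+[16K′+4]≡4[mod16] : ∀ α K K′ → ∃[ q ] (2 * α + 1) * (16 * K) + (16 * K′ + 4) ≡ 16 * q + 4
    odd*16K+[16K′+4]≡4[mod16] α K K′ = (2 * α + 1) * K + K′ , solve (α ∷ K ∷ K′ ∷ [])

  ≡12[mod16]⇒admissible : ∀ α κ μ s {x y z w} →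
    (2 * α + 1) * (x * x + 3 * (y * y)) + ((16 * κ + 4) * (z * z) + (16 * μ + 4) * (w * w)) ≡ 16 * s + 12 →
    Admissible x y × z %ℕ 2 ≡ w %ℕ 2
  ≡12[mod16]⇒admissible α κ μ s {x} {y} {z} {w} = combine (norm-residue x y) (weighted-residue κ μ z w)
    where
    ≡4[mod8] : ∀ {X} → X ≡ 16 * s + 12 → ∃[ q ] X ≡ 8 * q + 4
    ≡4[mod8] e = 2 * s + 1 , trans e (solve (s ∷ []))
    ≡0[mod2] : ∀ {X} → X ≡ 16 * s + 12 → ∃[ q ] X ≡ 2 * q + 0
    ≡0[mod2] e = 8 * s + 6 , trans e (solve (s ∷ []))
    combine : ∀ {N G} → NormResidue x y N → WeightedResidue z w G → (2 * α + 1) * N + G ≡ 16 * s + 12 →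
              Admissible x y × z %ℕ 2 ≡ w %ℕ 2
    combine (inj₁ (adm , _)) (inj₁ (same , _)) _ = adm , same
    combine (inj₁ (_ , K , refl)) (inj₂ (K′ , refl)) e =
      ⊥-elim (incongruent 8 (ℕP.<ᵇ⇒< 0 8 _) (ℕP.<ᵇ⇒< 4 8 _) (λ ()) (odd*[8K+4]+[16K′+4]≡0[mod8] α K K′) (≡4[mod8] e))
    combine (inj₂ (inj₁ (K , refl))) (inj₁ (_ , K′ , refl)) e =
      ⊥-elim (incongruent 2 (ℕP.<ᵇ⇒< 1 2 _) (ℕP.<ᵇ⇒< 0 2 _) (λ ()) (odd*odd+8K′≡1[mod2] α K K′) (≡0[mod2] e))
    combine (inj₂ (inj₁ (K , refl))) (inj₂ (K′ , refl)) e =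
      ⊥-elim (incongruent 2 (ℕP.<ᵇ⇒< 1 2 _) (ℕP.<ᵇ⇒< 0 2 _) (λ ()) (odd*odd+[16K′+4]≡1[mod2] α K K′) (≡0[mod2] e))
    combine (inj₂ (inj₂ (K , refl))) (inj₁ (_ , K′ , refl)) e =
      ⊥-elim (incongruent 8 (ℕP.<ᵇ⇒< 0 8 _) (ℕP.<ᵇ⇒< 4 8 _) (λ ()) (odd*16K+8K′≡0[mod8] α K K′) (≡4[mod8] e))
    combine (inj₂ (inj₂ (K , refl))) (inj₂ (K′ , refl)) e =
      ⊥-elim (incongruent 16 (ℕP.<ᵇ⇒< 4 16 _) (ℕP.<ᵇ⇒< 12 16 _) (λ ()) (odd*16K+[16K′+4]≡4[mod16] α K K′) (s , e))

module Boxes where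
  open import Data.Nat using (_+_; _*_; _∸_)

  Q4 : Set
  Q4 = ℤ × ℤ × ℤ × ℤ

  concatMap-unique : ∀ {A B : Set} (f : A → List B) (key : B → A) →
    (∀ x → All.All (λ b → key b ≡ x) (f x)) → (∀ x → Unique (f x)) →
    ∀ {xs} → Unique xs → Unique (concatMap f xs)
  concatMap-unique f key keyed f! {xs} xs! =
    Unique.concat⁺ (AllP.map⁺ (All.universal f! xs)) (AllPairsP.map⁺ (AllPairs.map disjoint xs!))
    where
    disjoint : ∀ {x x′} → x ≢ x′ → ∀ {b} → ¬ (b ∈ f x × b ∈ f x′)
    disjoint x≢x′ (b∈fx , b∈fx′) = x≢x′ (trans (sym (All.lookup (keyed _) b∈fx)) (All.lookup (keyed _) b∈fx′))

  All-concatMap : ∀ {A B : Set} {P : Pred B 0ℓ} (f : A → List B) →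
                  (∀ x → All.All P (f x)) → ∀ xs → All.All P (concatMap f xs)
  All-concatMap f Pf xs = AllP.concat⁺ (AllP.map⁺ (All.universal Pf xs))

  ∈-concatMap : ∀ {A B : Set} (f : A → List B) {x xs b} → x ∈ xs → b ∈ f x → b ∈ concatMap f xs
  ∈-concatMap f x∈ b∈ = ∈-concatMap⁺ f (Any.map (λ x≡ → subst (λ t → _ ∈ f t) x≡ b∈) x∈)

  range-unique : ∀ B → Unique (range B)
  range-unique B =
    Unique.++⁺ (Unique.map⁺ ℤP.+-injective (Unique.upTo⁺ (suc B))) (Unique.map⁺ ℤP.-[1+-injective (Unique.upTo⁺ B)) disjoint
    where
    disjoint : ∀ {v} → ¬ (v ∈ map +_ (upTo (suc B)) × v ∈ map -[1+_] (upTo B))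
    disjoint (v∈⁺ , v∈⁻) with ∈-map⁻ +_ v∈⁺ | ∈-map⁻ -[1+_] v∈⁻
    ... | _ , _ , refl | _ , _ , ()

  ∈-range : ∀ {B x} → ∣ x ∣ ≤ B → x ∈ range B
  ∈-range {B} {+ n} n≤B = ∈-++⁺ˡ (∈-map⁺ +_ (∈-upTo⁺ (s≤s n≤B)))
  ∈-range {B} { -[1+ n ]} n<B = ∈-++⁺ʳ (map +_ (upTo (suc B))) (∈-map⁺ -[1+_] (∈-upTo⁺ n<B))

  module _ (B : ℕ) where
    private
      line : ℤ → ℤ → ℤ → List Q4
      line x y z = map (λ w → x , y , z , w) (range B)
      plane : ℤ → ℤ → List Q4
      plane x y = concatMap (line x y) (range B)
      space : ℤ → List Q4
      space x = concatMap (plane x) (range B)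

    ∈-box : ∀ {x y z w} → ∣ x ∣ ≤ B → ∣ y ∣ ≤ B → ∣ z ∣ ≤ B → ∣ w ∣ ≤ B → (x , y , z , w) ∈ box B
    ∈-box {x} {y} {z} x≤ y≤ z≤ w≤ =
      ∈-concatMap space (∈-range x≤) (∈-concatMap (plane x) (∈-range y≤)
        (∈-concatMap (line x y) (∈-range z≤) (∈-map⁺ _ (∈-range w≤))))

    box-unique : Unique (box B)
    box-unique =
      concatMap-unique space proj₁ (λ x → on-space (λ _ _ _ → refl)) (λ x →
        concatMap-unique (plane x) (proj₁ ∘ proj₂) (λ y → on-plane (λ _ _ → refl)) (λ y →
          concatMap-unique (line x y) (proj₁ ∘ proj₂ ∘ proj₂) (λ z → on-line (λ _ → refl)) (λ z →
            Unique.map⁺ (cong (proj₂ ∘ proj₂ ∘ proj₂)) (range-unique B)) r!) r!) r!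
      where
      r! : Unique (range B)
      r! = range-unique B
      on-line : ∀ {P : Pred Q4 0ℓ} {x y z} → (∀ w → P (x , y , z , w)) → All.All P (line x y z)
      on-line Pw = AllP.map⁺ (All.universal Pw (range B))
      on-plane : ∀ {P : Pred Q4 0ℓ} {x y} → (∀ z w → P (x , y , z , w)) → All.All P (plane x y)
      on-plane {x = x} {y} Pzw = All-concatMap (line x y) (λ z → on-line (Pzw z)) (range B)
      on-space : ∀ {P : Pred Q4 0ℓ} {x} → (∀ y z w → P (x , y , z , w)) → All.All P (space x)
      on-space {x = x} Pyzw = All-concatMap (plane x) (λ y → on-plane (Pyzw y)) (range B)

  private
    ≤-square : ∀ n → n ≤ n * n
    ≤-square zero    = z≤n
    ≤-square (suc n) = ℕP.m≤m*n (suc n) (suc n)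

    ≤-scaled : ∀ {a} p → 0 < a → p ≤ a * p
    ≤-scaled {suc a} p _ = ℕP.m≤m+n p (a * p)

  summands-bounded : ∀ {a b c d p q r s M} → a * p + b * q + c * r + d * s ≡ M →
    0 < a → 0 < b → 0 < c → 0 < d → p ≤ M × q ≤ M × r ≤ M × s ≤ M
  summands-bounded {a} {b} {c} {d} {p} {q} {r} {s} refl a>0 b>0 c>0 d>0 =
    ℕP.≤-trans (≤-scaled p a>0)
      (ℕP.≤-trans (ℕP.m≤m+n (a * p) (b * q)) (ℕP.≤-trans (ℕP.m≤m+n _ (c * r)) (ℕP.m≤m+n _ (d * s)))) ,
    ℕP.≤-trans (≤-scaled q b>0)
      (ℕP.≤-trans (ℕP.m≤n+m (b * q) (a * p)) (ℕP.≤-trans (ℕP.m≤m+n _ (c * r)) (ℕP.m≤m+n _ (d * s)))) ,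
    ℕP.≤-trans (≤-scaled r c>0) (ℕP.≤-trans (ℕP.m≤n+m (c * r) (a * p + b * q)) (ℕP.m≤m+n _ (d * s))) ,
    ℕP.≤-trans (≤-scaled s d>0) (ℕP.m≤n+m (d * s) (a * p + b * q + c * r))

  pos-weighted-sum : ∀ a b c d {X Y Z W p q r s} → X ≡ + p → Y ≡ + q → Z ≡ + r → W ≡ + s →
    + a Int.* X Int.+ + b Int.* Y Int.+ + c Int.* Z Int.+ + d Int.* W ≡ + (a * p + b * q + c * r + d * s)
  pos-weighted-sum a b c d {p = p} {q} {r} {s} refl refl refl refl = sym (begin
    + (a * p + b * q + c * r + d * s)                ≡⟨ ℤP.pos-+ (a * p + b * q + c * r) (d * s) ⟩
    + (a * p + b * q + c * r) Int.+ + (d * s)        ≡⟨ cong (Int._+ + (d * s)) (ℤP.pos-+ (a * p + b * q) (c * r)) ⟩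
    + (a * p + b * q) Int.+ + (c * r) Int.+ + (d * s)
      ≡⟨ cong (λ t → t Int.+ + (c * r) Int.+ + (d * s)) (ℤP.pos-+ (a * p) (b * q)) ⟩
    + (a * p) Int.+ + (b * q) Int.+ + (c * r) Int.+ + (d * s)
      ≡⟨ cong₂ Int._+_ (cong₂ Int._+_ (cong₂ Int._+_ (ℤP.pos-* a p) (ℤP.pos-* b q)) (ℤP.pos-* c r)) (ℤP.pos-* d s) ⟩
    + a Int.* + p Int.+ + b Int.* + q Int.+ + c Int.* + r Int.+ + d Int.* + s ∎)
    where open ≡-Reasoning

  square≡∣∣² : ∀ x → x Int.* x ≡ + (∣ x ∣ * ∣ x ∣)
  square≡∣∣² (+ n)    = sym (ℤP.pos-* n n)
  square≡∣∣² -[1+ n ] = refl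

  ∈-box-quadForm : ∀ {a b c d M} → 0 < a → 0 < b → 0 < c → 0 < d →
    ∀ {q} → quadForm a b c d q ≡ + M → q ∈ box M
  ∈-box-quadForm {a} {b} {c} {d} {M} a>0 b>0 c>0 d>0 {x , y , z , w} eq =
    let x≤ , y≤ , z≤ , w≤ = summands-bounded (ℤP.+-injective (trans (sym squares) eq)) a>0 b>0 c>0 d>0
    in ∈-box M (ℕP.≤-trans (≤-square ∣ x ∣) x≤) (ℕP.≤-trans (≤-square ∣ y ∣) y≤)
               (ℕP.≤-trans (≤-square ∣ z ∣) z≤) (ℕP.≤-trans (≤-square ∣ w ∣) w≤)
    where
    squares : quadForm a b c d (x , y , z , w) ≡ + (a * (∣ x ∣ * ∣ x ∣) + b * (∣ y ∣ * ∣ y ∣) + c * (∣ z ∣ * ∣ z ∣) + d * (∣ w ∣ * ∣ w ∣))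
    squares = pos-weighted-sum a b c d (square≡∣∣² x) (square≡∣∣² y) (square≡∣∣² z) (square≡∣∣² w)

  tri2ℕ : ℤ → ℕ
  tri2ℕ (+ n)    = n * (n ∸ 1)
  tri2ℕ -[1+ n ] = suc n * suc (suc n)

  tri2≡+tri2ℕ : ∀ x → tri2 x ≡ + tri2ℕ x
  tri2≡+tri2ℕ (+ zero)  = refl
  tri2≡+tri2ℕ (+ suc n) = ℤP.+◃n≡+n _
  tri2≡+tri2ℕ -[1+ n ]  = cong (λ t → + (suc n * suc (suc t))) (ℕP.+-identityʳ n)

  ∣x∣≤1+tri2ℕ : ∀ x → ∣ x ∣ ≤ suc (tri2ℕ x)
  ∣x∣≤1+tri2ℕ (+ zero)  = z≤n
  ∣x∣≤1+tri2ℕ (+ suc n) = s≤s (ℕP.m≤m+n n _)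
  ∣x∣≤1+tri2ℕ -[1+ n ]  = ℕP.≤-trans (ℕP.m≤m*n (suc n) (suc (suc n))) (ℕP.n≤1+n _)

  ∈-box-triForm2 : ∀ {a b c d K} → 0 < a → 0 < b → 0 < c → 0 < d →
    ∀ {q} → triForm2 a b c d q ≡ + K → q ∈ box (suc K)
  ∈-box-triForm2 {a} {b} {c} {d} {K} a>0 b>0 c>0 d>0 {x , y , z , w} eq =
    let x≤ , y≤ , z≤ , w≤ = summands-bounded (ℤP.+-injective (trans (sym products) eq)) a>0 b>0 c>0 d>0
    in ∈-box (suc K) (ℕP.≤-trans (∣x∣≤1+tri2ℕ x) (s≤s x≤)) (ℕP.≤-trans (∣x∣≤1+tri2ℕ y) (s≤s y≤))
                     (ℕP.≤-trans (∣x∣≤1+tri2ℕ z) (s≤s z≤)) (ℕP.≤-trans (∣x∣≤1+tri2ℕ w) (s≤s w≤))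
    where
    products : triForm2 a b c d (x , y , z , w) ≡ + (a * tri2ℕ x + b * tri2ℕ y + c * tri2ℕ z + d * tri2ℕ w)
    products = pos-weighted-sum a b c d (tri2≡+tri2ℕ x) (tri2≡+tri2ℕ y) (tri2≡+tri2ℕ z) (tri2≡+tri2ℕ w)

module Rotation where
  open Int using (_+_; _*_; _-_; -_)
  open Parity

  norm : ℤ × ℤ → ℤ
  norm (x , y) = x * x + 3 * (y * y)

  -- Multiplication of x + y√-3 by (1 + √-3)/2, resp. (1 - √-3)/2; the halving is exact when x ≡ y (mod 2).
  rotate : ℤ × ℤ → ℤ × ℤ
  rotate (x , y) = half (x - 3 * y) , half (x + y)

  rotate⁻¹ : ℤ × ℤ → ℤ × ℤ
  rotate⁻¹ (x , y) = half (x + 3 * y) , half (y - x)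

  private
    [2s-y]-3y≡2[s-2y] : ∀ s y → 2 * s - y - 3 * y ≡ 2 * (s - 2 * y)
    [2s-y]-3y≡2[s-2y] = solve-∀
    [2s-y]+y≡2s : ∀ s y → 2 * s - y + y ≡ 2 * s
    [2s-y]+y≡2s = solve-∀
    [2s-y]+3y≡2[s+y] : ∀ s y → 2 * s - y + 3 * y ≡ 2 * (s + y)
    [2s-y]+3y≡2[s+y] = solve-∀
    y-[2s-y]≡2[y-s] : ∀ s y → y - (2 * s - y) ≡ 2 * (y - s)
    y-[2s-y]≡2[y-s] = solve-∀
    [s-2y]+3s≡2[2s-y] : ∀ s y → s - 2 * y + 3 * s ≡ 2 * (2 * s - y)
    [s-2y]+3s≡2[2s-y] = solve-∀
    s-[s-2y]≡2y : ∀ s y → s - (s - 2 * y) ≡ 2 * y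
    s-[s-2y]≡2y = solve-∀
    [s+y]-3[y-s]≡2[2s-y] : ∀ s y → s + y - 3 * (y - s) ≡ 2 * (2 * s - y)
    [s+y]-3[y-s]≡2[2s-y] = solve-∀
    [s+y]+[y-s]≡2y : ∀ s y → s + y + (y - s) ≡ 2 * y
    [s+y]+[y-s]≡2y = solve-∀
    norm[s-2y,s]≡norm[2s-y,y] : ∀ s y → (s - 2 * y) * (s - 2 * y) + 3 * (s * s) ≡ (2 * s - y) * (2 * s - y) + 3 * (y * y)
    norm[s-2y,s]≡norm[2s-y,y] = solve-∀
    norm[s+y,y-s]≡norm[2s-y,y] : ∀ s y → (s + y) * (s + y) + 3 * ((y - s) * (y - s)) ≡ (2 * s - y) * (2 * s - y) + 3 * (y * y)
    norm[s+y,y-s]≡norm[2s-y,y] = solve-∀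
    s-2y≡s+2[-y] : ∀ s y → s - 2 * y ≡ s + 2 * (- y)
    s-2y≡s+2[-y] = solve-∀
    [s-2y]+s≡2[s-y] : ∀ s y → s - 2 * y + s ≡ 2 * (s - y)
    [s-2y]+s≡2[s-y] = solve-∀
    s-y≡[s+y]+2[-y] : ∀ s y → s - y ≡ s + y + 2 * (- y)
    s-y≡[s+y]+2[-y] = solve-∀

  data SameParity : ℤ → ℤ → Set where
    param : ∀ s y → SameParity (2 * s - y) y

  same-parity : ∀ {x y} → x %ℕ 2 ≡ y %ℕ 2 → SameParity x y
  same-parity {x} {y} eq with same-parity⇒ {x} {y} eq
  ... | s , refl = param s y

  HalfSumOdd : ℤ × ℤ → Set
  HalfSumOdd (x , y) = Odd (half (x + y))

  private
    rotate-param : ∀ s y → rotate (2 * s - y , y) ≡ (s - 2 * y , s)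
    rotate-param s y = cong₂ _,_ (half-exact (s - 2 * y) ([2s-y]-3y≡2[s-2y] s y)) (half-exact s ([2s-y]+y≡2s s y))

    rotate⁻¹-param : ∀ s y → rotate⁻¹ (2 * s - y , y) ≡ (s + y , y - s)
    rotate⁻¹-param s y = cong₂ _,_ (half-exact (s + y) ([2s-y]+3y≡2[s+y] s y)) (half-exact (y - s) (y-[2s-y]≡2[y-s] s y))

    half-param : ∀ s y → half (2 * s - y + y) ≡ s
    half-param s y = half-exact s ([2s-y]+y≡2s s y)

  rotate⁻¹∘rotate : ∀ {x y} → SameParity x y → rotate⁻¹ (rotate (x , y)) ≡ (x , y)
  rotate⁻¹∘rotate (param s y) =
    trans (cong rotate⁻¹ (rotate-param s y))
          (cong₂ _,_ (half-exact (2 * s - y) ([s-2y]+3s≡2[2s-y] s y)) (half-exact y (s-[s-2y]≡2y s y)))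

  rotate∘rotate⁻¹ : ∀ {x y} → SameParity x y → rotate (rotate⁻¹ (x , y)) ≡ (x , y)
  rotate∘rotate⁻¹ (param s y) =
    trans (cong rotate (rotate⁻¹-param s y))
          (cong₂ _,_ (half-exact (2 * s - y) ([s+y]-3[y-s]≡2[2s-y] s y)) (half-exact y ([s+y]+[y-s]≡2y s y)))

  norm-rotate : ∀ {x y} → SameParity x y → norm (rotate (x , y)) ≡ norm (x , y)
  norm-rotate (param s y) = trans (cong norm (rotate-param s y)) (norm[s-2y,s]≡norm[2s-y,y] s y)

  norm-rotate⁻¹ : ∀ {x y} → SameParity x y → norm (rotate⁻¹ (x , y)) ≡ norm (x , y)
  norm-rotate⁻¹ (param s y) = trans (cong norm (rotate⁻¹-param s y)) (norm[s+y,y-s]≡norm[2s-y,y] s y)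

  rotate-A⊆E : ∀ {x y} → SameParity x y → ¬ HalfSumOdd (x , y) → ¬ Odd (proj₁ (rotate (x , y)))
  rotate-A⊆E (param s y) ¬half = subst (λ p → ¬ Odd (proj₁ p)) (sym (rotate-param s y))
    (¬odd-shift s (- y) (s-2y≡s+2[-y] s y) (λ s-odd → ¬half (subst Odd (sym (half-param s y)) s-odd)))

  rotate-E⊆B : ∀ {x y} → SameParity x y → HalfSumOdd (x , y) → ¬ Odd y →
               Odd (proj₁ (rotate (x , y))) × HalfSumOdd (rotate (x , y))
  rotate-E⊆B (param s y) half-odd y-even = subst (λ p → Odd (proj₁ p) × HalfSumOdd p) (sym (rotate-param s y))
    (odd-shift s (- y) (s-2y≡s+2[-y] s y) s-odd ,
     subst Odd (sym (half-exact (s - y) ([s-2y]+s≡2[s-y] s y)))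
               (odd-shift (s + y) (- y) (s-y≡[s+y]+2[-y] s y) (odd+even s-odd y-even)))
    where
    s-odd : Odd s
    s-odd = subst Odd (half-param s y) half-odd

  rotate⁻¹-E⊆A : ∀ {x y} → SameParity x y → HalfSumOdd (x , y) → ¬ Odd y →
                 Odd (proj₁ (rotate⁻¹ (x , y))) × ¬ HalfSumOdd (rotate⁻¹ (x , y))
  rotate⁻¹-E⊆A (param s y) half-odd y-even = subst (λ p → Odd (proj₁ p) × ¬ HalfSumOdd p) (sym (rotate⁻¹-param s y))
    (odd+even (subst Odd (half-param s y) half-odd) y-even , subst (λ t → ¬ Odd t) (sym (half-exact y ([s+y]+[y-s]≡2y s y))) y-even)

  rotate⁻¹-B⊆E : ∀ {x y} → SameParity x y → HalfSumOdd (x , y) → Odd y → ¬ Odd (proj₁ (rotate⁻¹ (x , y)))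
  rotate⁻¹-B⊆E (param s y) half-odd y-odd = subst (λ p → ¬ Odd (proj₁ p)) (sym (rotate⁻¹-param s y))
    (odd+odd (subst Odd (half-param s y) half-odd) y-odd)

module Rescaling where
  open Int using (_+_; _*_; _-_)
  open import Algebra.Bundles using (AbelianGroup)
  open import Algebra.Properties.Group (AbelianGroup.group ℤP.+-0-abelianGroup) using (∙-cancelʳ)
  open Counting
  open EuclideanDivision
  open Parity
  open Boxes

  solution? : ∀ a b c d M → Decidable (λ q → quadForm a b c d q ≡ + M)
  solution? a b c d M q = quadForm a b c d q Int.≟ + M

  All4 : Pred ℤ 0ℓ → Pred Q4 0ℓ
  All4 P (x , y , z , w) = P x × P y × P z × P w

  all4? : ∀ {P : Pred ℤ 0ℓ} → Decidable P → Decidable (All4 P)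
  all4? P? (x , y , z , w) = P? x ×-dec P? y ×-dec P? z ×-dec P? w

  map4 : (ℤ → ℤ) → Q4 → Q4
  map4 f (x , y , z , w) = f x , f y , f z , f w

  map4-cancel : ∀ {P : Pred ℤ 0ℓ} f g → (∀ {x} → P x → g (f x) ≡ x) → ∀ {q} → All4 P q → map4 g (map4 f q) ≡ q
  map4-cancel _ _ cancel (px , py , pz , pw) = cong₂ _,_ (cancel px) (cong₂ _,_ (cancel py) (cong₂ _,_ (cancel pz) (cancel pw)))

  private
    quadForm-at-odds : ∀ A B C D x y z w →
      A * ((2 * x - 1) * (2 * x - 1)) + B * ((2 * y - 1) * (2 * y - 1))
        + C * ((2 * z - 1) * (2 * z - 1)) + D * ((2 * w - 1) * (2 * w - 1))
      ≡ 4 * (A * (x * (x - 1)) + B * (y * (y - 1)) + C * (z * (z - 1)) + D * (w * (w - 1))) + (A + B + C + D)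
    quadForm-at-odds = solve-∀

    quadForm-at-evens : ∀ A B C D x y z w →
      A * (2 * x * (2 * x)) + B * (2 * y * (2 * y)) + C * (2 * z * (2 * z)) + D * (2 * w * (2 * w))
      ≡ 4 * (A * (x * x) + B * (y * y) + C * (z * z) + D * (w * w))
    quadForm-at-evens = solve-∀

    2[x-1]+1 : ∀ x → 2 * x - 1 ≡ 2 * (x - 1) + 1
    2[x-1]+1 = solve-∀

    2[h+1]-1 : ∀ h → 2 * (h + 1) - 1 ≡ 2 * h + 1
    2[h+1]-1 = solve-∀

    [x-1]+1 : ∀ x → x - 1 + 1 ≡ x
    [x-1]+1 = solve-∀

  module Coefficients (a b c d : ℕ) (a>0 : 0 < a) (b>0 : 0 < b) (c>0 : 0 < c) (d>0 : 0 < d) where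

    private
      S : ℤ
      S = + a + + b + + c + + d

      S≡ : S ≡ + (a ℕ.+ b ℕ.+ c ℕ.+ d)
      S≡ = sym (trans (ℤP.pos-+ (a ℕ.+ b ℕ.+ c) d)
                      (cong (_+ + d) (trans (ℤP.pos-+ (a ℕ.+ b) c) (cong (_+ + c) (ℤP.pos-+ a b)))))

      odd-embedding : ∀ q → quadForm a b c d (map4 (λ x → 2 * x - 1) q) ≡ 4 * triForm2 a b c d q + S
      odd-embedding (x , y , z , w) = quadForm-at-odds (+ a) (+ b) (+ c) (+ d) x y z w

      even-embedding : ∀ q → quadForm a b c d (map4 (2 *_) q) ≡ 4 * quadForm a b c d q
      even-embedding (x , y , z , w) = quadForm-at-evens (+ a) (+ b) (+ c) (+ d) x y z w

    t≡count-all-odd : ∀ n M → M ≡ 4 ℕ.* (2 ℕ.* n) ℕ.+ (a ℕ.+ b ℕ.+ c ℕ.+ d) →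
      t a b c d n ≡ count (solution? a b c d M ∩? all4? odd?) (box M)
    t≡count-all-odd n M M≡ = count-bijection tri? (solution? a b c d M ∩? all4? odd?)
      double-1 halve+1 (box-unique (suc (2 ℕ.* n))) (box-unique M)
      (∈-box-triForm2 a>0 b>0 c>0 d>0) (λ sol → ∈-box-quadForm a>0 b>0 c>0 d>0 (proj₁ sol)) forth back
      where
      tri? : Decidable (λ q → triForm2 a b c d q ≡ + (2 ℕ.* n))
      tri? q = triForm2 a b c d q Int.≟ + (2 ℕ.* n)
      double-1 halve+1 : Q4 → Q4
      double-1 = map4 (λ x → 2 * x - 1)
      halve+1 = map4 (λ x → half x + 1)
      +M≡ : + M ≡ 4 * + (2 ℕ.* n) + S
      +M≡ = trans (cong +_ M≡) (trans (pos-*-+ 4 (2 ℕ.* n) _) (cong (_+_ (4 * + (2 ℕ.* n))) (sym S≡)))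
      odd-2x-1 : ∀ x → Odd (2 * x - 1)
      odd-2x-1 x = odd-by (x - 1) (2[x-1]+1 x)
      half[2x-1]+1 : ∀ x → half (2 * x - 1) + 1 ≡ x
      half[2x-1]+1 x = trans (cong (λ h → h + 1) (half-exact-odd (x - 1) (2[x-1]+1 x))) ([x-1]+1 x)
      forth : ∀ {q} → triForm2 a b c d q ≡ + (2 ℕ.* n) →
              (quadForm a b c d (double-1 q) ≡ + M × All4 Odd (double-1 q)) × halve+1 (double-1 q) ≡ q
      forth {x , y , z , w} e =
        (sol , odd-2x-1 x , odd-2x-1 y , odd-2x-1 z , odd-2x-1 w) ,
        map4-cancel {P = λ _ → ⊤} (λ x → 2 * x - 1) (λ x → half x + 1) (λ {x} _ → half[2x-1]+1 x) (tt , tt , tt , tt)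
        where
        sol : quadForm a b c d (double-1 (x , y , z , w)) ≡ + M
        sol = trans (odd-embedding (x , y , z , w)) (trans (cong (λ T → 4 * T + S) e) (sym +M≡))
      back : ∀ {q} → quadForm a b c d q ≡ + M × All4 Odd q →
             triForm2 a b c d (halve+1 q) ≡ + (2 ℕ.* n) × double-1 (halve+1 q) ≡ q
      back {q} (sol , all-odd) = tri , restore
        where
        restore : double-1 (halve+1 q) ≡ q
        restore = map4-cancel (λ x → half x + 1) (λ x → 2 * x - 1)
                    (λ {x} x-odd → trans (2[h+1]-1 (half x)) (sym (odd⇒ x-odd))) all-odd
        tri : triForm2 a b c d (halve+1 q) ≡ + (2 ℕ.* n)
        tri = ℤP.*-cancelˡ-≡ 4 _ _ (∙-cancelʳ S _ _ (begin
          4 * triForm2 a b c d (halve+1 q) + S   ≡⟨ sym (odd-embedding (halve+1 q)) ⟩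
          quadForm a b c d (double-1 (halve+1 q)) ≡⟨ cong (quadForm a b c d) restore ⟩
          quadForm a b c d q                      ≡⟨ trans sol +M≡ ⟩
          4 * + (2 ℕ.* n) + S                     ∎))
          where open ≡-Reasoning

    N≡count-all-even : ∀ K M → M ≡ 4 ℕ.* K → N a b c d K ≡ count (solution? a b c d M ∩? all4? (∁? odd?)) (box M)
    N≡count-all-even K M M≡ = count-bijection (solution? a b c d K) (solution? a b c d M ∩? all4? (∁? odd?))
      (map4 (2 *_)) (map4 half) (box-unique K) (box-unique M)
      (∈-box-quadForm a>0 b>0 c>0 d>0) (λ sol → ∈-box-quadForm a>0 b>0 c>0 d>0 (proj₁ sol)) forth back
      where
      +M≡ : + M ≡ 4 * + K
      +M≡ = trans (cong +_ M≡) (ℤP.pos-* 4 K)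
      forth : ∀ {q} → quadForm a b c d q ≡ + K →
              (quadForm a b c d (map4 (2 *_) q) ≡ + M × All4 (∁ Odd) (map4 (2 *_) q)) ×
              map4 half (map4 (2 *_) q) ≡ q
      forth {x , y , z , w} e =
        (sol , ¬odd-double x , ¬odd-double y , ¬odd-double z , ¬odd-double w) ,
        map4-cancel {P = λ _ → ⊤} (2 *_) half (λ {x} _ → half-exact x refl) (tt , tt , tt , tt)
        where
        sol : quadForm a b c d (map4 (2 *_) (x , y , z , w)) ≡ + M
        sol = trans (even-embedding (x , y , z , w)) (trans (cong (4 *_) e) (sym +M≡))
      back : ∀ {q} → quadForm a b c d q ≡ + M × All4 (∁ Odd) q →
             quadForm a b c d (map4 half q) ≡ + K × map4 (2 *_) (map4 half q) ≡ q
      back {q} (sol , all-even) = quad , restore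
        where
        restore : map4 (2 *_) (map4 half q) ≡ q
        restore = map4-cancel half (2 *_) (λ x-even → sym (¬odd⇒ x-even)) all-even
        quad : quadForm a b c d (map4 half q) ≡ + K
        quad = ℤP.*-cancelˡ-≡ 4 _ _ (begin
          4 * quadForm a b c d (map4 half q)           ≡⟨ sym (even-embedding (map4 half q)) ⟩
          quadForm a b c d (map4 (2 *_) (map4 half q)) ≡⟨ cong (quadForm a b c d) restore ⟩
          quadForm a b c d q                           ≡⟨ trans sol +M≡ ⟩
          4 * + K                                      ∎)
          where open ≡-Reasoning

module Classification (a c d M : ℕ)
  (a-odd : a ℕ.% 2 ≡ 1) (c≡4 : c ℕ.% 16 ≡ 4) (d≡4 : d ℕ.% 16 ≡ 4) (M≡12 : M ℕ.% 16 ≡ 12) where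
  open Int using (_+_; _*_; _-_)
  open Counting
  open EuclideanDivision
  open Parity
  open Residues
  open Boxes
  open Rotation
  open Rescaling

  F : Q4 → ℤ
  F = quadForm a (3 ℕ.* a) c d

  Sol : Pred Q4 0ℓ
  Sol q = F q ≡ + M

  sol? : Decidable Sol
  sol? = solution? a (3 ℕ.* a) c d M

  L : List Q4
  L = box M

  private
    residue-form : ∀ m n {r} .{{_ : ℕ.NonZero n}} → m ℕ.% n ≡ r → + m ≡ + n * + (m ℕ./ n) + + r
    residue-form m n {r} e = trans (cong +_ m≡) (pos-*-+ n (m ℕ./ n) r)
      where
      m≡ : m ≡ n ℕ.* (m ℕ./ n) ℕ.+ r
      m≡ = trans (m≡m%n+[m/n]*n m n)
                 (trans (cong (ℕ._+ (m ℕ./ n) ℕ.* n) e) (trans (ℕP.+-comm r _) (cong (ℕ._+ r) (ℕP.*-comm (m ℕ./ n) n))))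

    %≡suc⇒positive : ∀ {m n r} → m ℕ.% suc n ≡ suc r → 0 < m
    %≡suc⇒positive {zero}  ()
    %≡suc⇒positive {suc m} _ = s≤s z≤n

    a>0 : 0 < a
    a>0 = %≡suc⇒positive a-odd

    split-norm : ∀ A X Y C Z D W → A * X + 3 * A * Y + C * Z + D * W ≡ A * (X + 3 * Y) + (C * Z + D * W)
    split-norm = solve-∀

  F-split : ∀ x y z w → F (x , y , z , w) ≡ + a * norm (x , y) + (+ c * (z * z) + + d * (w * w))
  F-split x y z w = trans (cong (λ B → + a * (x * x) + B * (y * y) + + c * (z * z) + + d * (w * w)) (ℤP.pos-* 3 a))
                          (split-norm (+ a) (x * x) (y * y) (+ c) (z * z) (+ d) (w * w))

  solution-admissible : ∀ x y z w → Sol (x , y , z , w) → Admissible x y × z %ℕ 2 ≡ w %ℕ 2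
  solution-admissible x y z w sol =
    ≡12[mod16]⇒admissible (+ (a ℕ./ 2)) (+ (c ℕ./ 16)) (+ (d ℕ./ 16)) (+ (M ℕ./ 16)) {x} {y} {z} {w} (begin
    (2 * + (a ℕ./ 2) + 1) * norm (x , y) + ((16 * + (c ℕ./ 16) + 4) * (z * z) + (16 * + (d ℕ./ 16) + 4) * (w * w))
      ≡⟨ cong₂ (λ A G → A * norm (x , y) + G) (sym (residue-form a 2 a-odd))
               (cong₂ (λ C D → C * (z * z) + D * (w * w)) (sym (residue-form c 16 c≡4)) (sym (residue-form d 16 d≡4))) ⟩
    + a * norm (x , y) + (+ c * (z * z) + + d * (w * w)) ≡⟨ sym (F-split x y z w) ⟩
    F (x , y , z , w)                                     ≡⟨ sol ⟩
    + M                                                   ≡⟨ residue-form M 16 M≡12 ⟩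
    16 * + (M ℕ./ 16) + 12                                ∎)
    where open ≡-Reasoning

  ∈L : ∀ {q} → Sol q → q ∈ L
  ∈L = ∈-box-quadForm {a} {3 ℕ.* a} {c} {d} {M} a>0 (ℕP.*-monoʳ-< 3 a>0) (%≡suc⇒positive c≡4) (%≡suc⇒positive d≡4)

  onXY : (ℤ × ℤ → ℤ × ℤ) → Q4 → Q4
  onXY f (x , y , z , w) = proj₁ (f (x , y)) , proj₂ (f (x , y)) , z , w

  onXY-cancel : ∀ f g x y z w → g (f (x , y)) ≡ (x , y) → onXY g (onXY f (x , y , z , w)) ≡ (x , y , z , w)
  onXY-cancel f g x y z w e = cong (λ p → proj₁ p , proj₂ p , z , w) e

  Sol-onXY : ∀ f x y z w → norm (f (x , y)) ≡ norm (x , y) → Sol (x , y , z , w) → Sol (onXY f (x , y , z , w))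
  Sol-onXY f x y z w e sol = begin
    F (onXY f (x , y , z , w))                                  ≡⟨ F-split (proj₁ (f (x , y))) (proj₂ (f (x , y))) z w ⟩
    + a * norm (f (x , y)) + (+ c * (z * z) + + d * (w * w))   ≡⟨ cong (λ n → + a * n + (+ c * (z * z) + + d * (w * w))) e ⟩
    + a * norm (x , y) + (+ c * (z * z) + + d * (w * w))       ≡⟨ sym (F-split x y z w) ⟩
    F (x , y , z , w)                                           ≡⟨ sol ⟩
    + M                                                         ∎
    where open ≡-Reasoning

  half-sum? : Decidable (λ (q : Q4) → HalfSumOdd (proj₁ q , proj₁ (proj₂ q)))
  half-sum? q = odd? (half (proj₁ q + proj₁ (proj₂ q)))

  -- The rotations fix z and w, so every class may be refined by a condition R on (z, w).
  module Classes {R : Pred (ℤ × ℤ) 0ℓ} (R? : Decidable R) where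

    SolR O E A B : Pred Q4 0ℓ
    SolR q = Sol q × R (proj₂ (proj₂ q))
    O q = SolR q × Odd (proj₁ q)
    E q = SolR q × ¬ Odd (proj₁ q)
    A q = O q × ¬ HalfSumOdd (proj₁ q , proj₁ (proj₂ q))
    B q = O q × HalfSumOdd (proj₁ q , proj₁ (proj₂ q))

    SolR? : Decidable SolR
    SolR? = sol? ∩? (R? ∘ proj₂ ∘ proj₂)

    O? : Decidable O
    O? = SolR? ∩? (odd? ∘ proj₁)

    E? : Decidable E
    E? = SolR? ∩? ∁? (odd? ∘ proj₁)

    A? : Decidable A
    A? = O? ∩? ∁? half-sum?

    B? : Decidable B
    B? = O? ∩? half-sum?

    private
      A→E : ∀ {q} → A q → E (onXY rotate q) × onXY rotate⁻¹ (onXY rotate q) ≡ q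
      A→E {x , y , z , w} (((sol , r) , _) , ¬half) =
        ((Sol-onXY rotate x y z w (norm-rotate sp) sol , r) , rotate-A⊆E sp ¬half) ,
        onXY-cancel rotate rotate⁻¹ x y z w (rotate⁻¹∘rotate sp)
        where
        sp : SameParity x y
        sp = same-parity (proj₁ (proj₁ (solution-admissible x y z w sol)))

      B→E : ∀ {q} → B q → E (onXY rotate⁻¹ q) × onXY rotate (onXY rotate⁻¹ q) ≡ q
      B→E {x , y , z , w} (((sol , r) , x-odd) , half-odd) =
        ((Sol-onXY rotate⁻¹ x y z w (norm-rotate⁻¹ sp) sol , r) , rotate⁻¹-B⊆E sp half-odd (odd-resp (sym same) x-odd)) ,
        onXY-cancel rotate⁻¹ rotate x y z w (rotate∘rotate⁻¹ sp)
        where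
        same : x %ℕ 2 ≡ y %ℕ 2
        same = proj₁ (proj₁ (solution-admissible x y z w sol))
        sp : SameParity x y
        sp = same-parity same

      E→A : ∀ {q} → E q → A (onXY rotate⁻¹ q) × onXY rotate (onXY rotate⁻¹ q) ≡ q
      E→A {x , y , z , w} ((sol , r) , x-even) =
        (((Sol-onXY rotate⁻¹ x y z w (norm-rotate⁻¹ sp) sol , r) , proj₁ E⊆A) , proj₂ E⊆A) ,
        onXY-cancel rotate⁻¹ rotate x y z w (rotate∘rotate⁻¹ sp)
        where
        adm : Admissible x y
        adm = proj₁ (solution-admissible x y z w sol)
        sp : SameParity x y
        sp = same-parity (proj₁ adm)
        E⊆A : Odd (proj₁ (rotate⁻¹ (x , y))) × ¬ HalfSumOdd (rotate⁻¹ (x , y))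
        E⊆A = rotate⁻¹-E⊆A sp (proj₂ adm x-even) (λ y-odd → x-even (odd-resp (proj₁ adm) y-odd))

      E→B : ∀ {q} → E q → B (onXY rotate q) × onXY rotate⁻¹ (onXY rotate q) ≡ q
      E→B {x , y , z , w} ((sol , r) , x-even) =
        (((Sol-onXY rotate x y z w (norm-rotate sp) sol , r) , proj₁ E⊆B) , proj₂ E⊆B) ,
        onXY-cancel rotate rotate⁻¹ x y z w (rotate⁻¹∘rotate sp)
        where
        adm : Admissible x y
        adm = proj₁ (solution-admissible x y z w sol)
        sp : SameParity x y
        sp = same-parity (proj₁ adm)
        E⊆B : Odd (proj₁ (rotate (x , y))) × HalfSumOdd (rotate (x , y))
        E⊆B = rotate-E⊆B sp (proj₂ adm x-even) (λ y-odd → x-even (odd-resp (proj₁ adm) y-odd))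

    count-O≡2E : count O? L ≡ 2 ℕ.* count E? L
    count-O≡2E = begin
      count O? L                                       ≡⟨ count-split O? half-sum? L ⟩
      count B? L ℕ.+ count A? L
        ≡⟨ cong₂ ℕ._+_ (count-bijection B? E? (onXY rotate⁻¹) (onXY rotate) L! L! O⊆L E⊆L B→E E→B)
                       (count-bijection A? E? (onXY rotate) (onXY rotate⁻¹) L! L! O⊆L E⊆L A→E E→A) ⟩
      count E? L ℕ.+ count E? L                        ≡⟨ cong (count E? L ℕ.+_) (sym (ℕP.+-identityʳ _)) ⟩
      2 ℕ.* count E? L                                 ∎
      where
      open ≡-Reasoning
      L! : Unique L
      L! = box-unique M
      O⊆L : ∀ {q} {X : Set} → O q × X → q ∈ L
      O⊆L (((sol , _) , _) , _) = ∈L sol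
      E⊆L : ∀ {q} → E q → q ∈ L
      E⊆L ((sol , _) , _) = ∈L sol

    count-SolR≡3E : count SolR? L ≡ 3 ℕ.* count E? L
    count-SolR≡3E =
      trans (count-split SolR? (odd? ∘ proj₁) L) (trans (cong (ℕ._+ count E? L) count-O≡2E) (ℕP.+-comm (2 ℕ.* count E? L) _))

  private
    odd-z? : Decidable (λ (p : ℤ × ℤ) → Odd (proj₁ p))
    odd-z? p = odd? (proj₁ p)

  module OddZ = Classes odd-z?
  module EvenZ = Classes (∁? odd-z?)

  private
    all-odd-count : count (sol? ∩? all4? odd?) L ≡ count OddZ.O? L
    all-odd-count = count-≐ (sol? ∩? all4? odd?) OddZ.O? (forget , restore) L
      where
      forget : ∀ {q} → Sol q × All4 Odd q → (Sol q × Odd (proj₁ (proj₂ (proj₂ q)))) × Odd (proj₁ q)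
      forget {x , y , z , w} (sol , x-odd , _ , z-odd , _) = (sol , z-odd) , x-odd
      restore : ∀ {q} → (Sol q × Odd (proj₁ (proj₂ (proj₂ q)))) × Odd (proj₁ q) → Sol q × All4 Odd q
      restore {x , y , z , w} ((sol , z-odd) , x-odd) =
        sol , x-odd , odd-resp (sym (proj₁ (proj₁ adm))) x-odd , z-odd , odd-resp (sym (proj₂ adm)) z-odd
        where
        adm : Admissible x y × z %ℕ 2 ≡ w %ℕ 2
        adm = solution-admissible x y z w sol

    all-even-count : count (sol? ∩? all4? (∁? odd?)) L ≡ count EvenZ.E? L
    all-even-count = count-≐ (sol? ∩? all4? (∁? odd?)) EvenZ.E? (forget , restore) L
      where
      forget : ∀ {q} → Sol q × All4 (∁ Odd) q → (Sol q × ¬ Odd (proj₁ (proj₂ (proj₂ q)))) × ¬ Odd (proj₁ q)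
      forget {x , y , z , w} (sol , x-even , _ , z-even , _) = (sol , z-even) , x-even
      restore : ∀ {q} → (Sol q × ¬ Odd (proj₁ (proj₂ (proj₂ q)))) × ¬ Odd (proj₁ q) → Sol q × All4 (∁ Odd) q
      restore {x , y , z , w} ((sol , z-even) , x-even) =
        sol , x-even , (λ y-odd → x-even (odd-resp (proj₁ (proj₁ adm)) y-odd)) ,
        z-even , (λ w-odd → z-even (odd-resp (proj₂ adm) w-odd))
        where
        adm : Admissible x y × z %ℕ 2 ≡ w %ℕ 2
        adm = solution-admissible x y z w sol

    3[2e₁]+6e₀≡2[3e₁+3e₀] : ∀ e₁ e₀ → 3 ℕ.* (2 ℕ.* e₁) ℕ.+ 6 ℕ.* e₀ ≡ 2 ℕ.* (3 ℕ.* e₁ ℕ.+ 3 ℕ.* e₀)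
    3[2e₁]+6e₀≡2[3e₁+3e₀] = ℕSolver.solve-∀

  3t+6N≡2N : ∀ n K → M ≡ 4 ℕ.* (2 ℕ.* n) ℕ.+ (a ℕ.+ 3 ℕ.* a ℕ.+ c ℕ.+ d) → M ≡ 4 ℕ.* K →
    3 ℕ.* t a (3 ℕ.* a) c d n ℕ.+ 6 ℕ.* N a (3 ℕ.* a) c d K ≡ 2 ℕ.* N a (3 ℕ.* a) c d M
  3t+6N≡2N n K M≡ M≡4K = begin
    3 ℕ.* t a (3 ℕ.* a) c d n ℕ.+ 6 ℕ.* N a (3 ℕ.* a) c d K
      ≡⟨ cong₂ (λ u v → 3 ℕ.* u ℕ.+ 6 ℕ.* v) (trans (t≡count-all-odd n M M≡) all-odd-count)
                                             (trans (N≡count-all-even K M M≡4K) all-even-count) ⟩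
    3 ℕ.* count OddZ.O? L ℕ.+ 6 ℕ.* count EvenZ.E? L
      ≡⟨ cong (λ u → 3 ℕ.* u ℕ.+ 6 ℕ.* count EvenZ.E? L) OddZ.count-O≡2E ⟩
    3 ℕ.* (2 ℕ.* count OddZ.E? L) ℕ.+ 6 ℕ.* count EvenZ.E? L
      ≡⟨ 3[2e₁]+6e₀≡2[3e₁+3e₀] (count OddZ.E? L) (count EvenZ.E? L) ⟩
    2 ℕ.* (3 ℕ.* count OddZ.E? L ℕ.+ 3 ℕ.* count EvenZ.E? L)
      ≡⟨ cong (2 ℕ.*_) (sym (cong₂ ℕ._+_ OddZ.count-SolR≡3E EvenZ.count-SolR≡3E)) ⟩
    2 ℕ.* (count OddZ.SolR? L ℕ.+ count EvenZ.SolR? L)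
      ≡⟨ cong (2 ℕ.*_) (sym (count-split sol? (odd-z? ∘ proj₂ ∘ proj₂) L)) ⟩
    2 ℕ.* N a (3 ℕ.* a) c d M ∎
    where
    open ≡-Reasoning
    open Rescaling.Coefficients a (3 ℕ.* a) c d a>0 (ℕP.*-monoʳ-< 3 a>0) (%≡suc⇒positive c≡4) (%≡suc⇒positive d≡4)

open import Data.Nat using (_+_; _*_; _%_; _/_; _∸_)

private
  M≡12+16* : ∀ {n a α} k m p q r → n ≡ r + p * 2 → a ≡ 1 + α * 2 → α ≡ r + q * 2 →
             8 * n + 16 * k + 16 * m + 4 * a + 8 ≡ 12 + (p + q + r + k + m) * 16
  M≡12+16* k m p q r refl refl refl = ℕSolver.solve (k ∷ m ∷ p ∷ q ∷ r ∷ [])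

  12[mod16] : ∀ a k m n → a % 2 ≡ 1 → n % 2 ≡ ((a ∸ 1) / 2) % 2 → (8 * n + 16 * k + 16 * m + 4 * a + 8) % 16 ≡ 12
  12[mod16] a k m n a-odd parity = trans (cong (_% 16) M≡) ([m+kn]%n≡m%n 12 (n / 2 + α / 2 + n % 2 + k + m) 16)
    where
    α : ℕ
    α = a / 2
    a≡ : a ≡ 1 + α * 2
    a≡ = trans (m≡m%n+[m/n]*n a 2) (cong (_+ α * 2) a-odd)
    [a-1]/2≡α : (a ∸ 1) / 2 ≡ α
    [a-1]/2≡α = trans (cong (λ t → (t ∸ 1) / 2) a≡) (m*n/n≡m α 2)
    α≡ : α ≡ n % 2 + (α / 2) * 2
    α≡ = trans (m≡m%n+[m/n]*n α 2) (cong (_+ (α / 2) * 2) (sym (trans parity (cong (_% 2) [a-1]/2≡α))))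
    M≡ : 8 * n + 16 * k + 16 * m + 4 * a + 8 ≡ 12 + (n / 2 + α / 2 + n % 2 + k + m) * 16
    M≡ = M≡12+16* k m (n / 2) (α / 2) (n % 2) (m≡m%n+[m/n]*n n 2) a≡ α≡

  16k+4≡4 : ∀ k → (16 * k + 4) % 16 ≡ 4
  16k+4≡4 k = trans (cong (_% 16) (trans (ℕP.+-comm (16 * k) 4) (cong (_+_ 4) (ℕP.*-comm 16 k)))) ([m+kn]%n≡m%n 4 k 16)

-- The identity holds for n = 0 as well.
theorem2p4 : (a k m n : ℕ) → a % 2 ≡ 1 → 1 ≤ n →
    n % 2 ≡ ((a ∸ 1) / 2) % 2 →
    3 * t a (3 * a) (16 * k + 4) (16 * m + 4) n
      + 6 * N a (3 * a) (16 * k + 4) (16 * m + 4) (2 * n + 4 * k + 4 * m + a + 2)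
      ≡ 2 * N a (3 * a) (16 * k + 4) (16 * m + 4) (8 * n + 16 * k + 16 * m + 4 * a + 8)
theorem2p4 a k m n a-odd _ parity =
  Classification.3t+6N≡2N a (16 * k + 4) (16 * m + 4) (8 * n + 16 * k + 16 * m + 4 * a + 8)
    a-odd (16k+4≡4 k) (16k+4≡4 m) (12[mod16] a k m n a-odd parity)
    n (2 * n + 4 * k + 4 * m + a + 2) (ℕSolver.solve (a ∷ k ∷ m ∷ n ∷ [])) (ℕSolver.solve (a ∷ k ∷ m ∷ n ∷ []))
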